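{- Every $(0,3,6)$-fullerene is isomorphic (as a plane graph) to a graph $G$ produced by the following construction. Let $\mathcal T$ be the infinite regular triangular grid in the Euclidean plane, whose vertices (gridpoints) are the points of the $A_2$ lattice $\{i\mathbf a + j\mathbf b : i,j\in\mathbb Z\}$, where $\mathbf a,\mathbf b$ are unit vectors with angle $\pi/3$ between them, and whose edges join gridpoints at distance $1$; the midpoint of an edge of $\mathcal T$ is called an edgepoint. (1) Choose a (nondegenerate) triangle $\triangle ABC$ with no obtuse angle whose vertices are gridpoints of $\mathcal T$, and let $\bar A,\bar B,\bar C$ be the midpoints of the sides opposite $A,B,C$ respectively. (2) Optionally, translate $\triangle ABC$ (together with $\bar A,\bar B,\bar C$), keeping $\mathcal T$ fixed, so that $A$ coincides with an edgepoint of $\mathcal T$. (3) Fold $\triangle ABC$ into the isosceles tetrahedron $Q=A\bar A\bar B\bar C$ by identifying the boundary segment $\bar A B$ with $\bar A C$, $\bar B C$ with $\bar B A$, and $\bar C A$ with $\bar C B$ (so $A,B,C$ become a single vertex of $Q$). The portion of $\mathcal T$ lying within $\triangle ABC$ becomes a finite graph $G^*$ drawn on the surface of $Q$ (which is a sphere), possibly with semiedges (an edge of $\mathcal T$ whose midpoint is one of the corners $A,\bar A,\bar B,\bar C$ becomes a semiedge). (4) Let $G$ be the plane dual of $G^*$.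
   Context: Graphs may have multiple edges and semiedges. A semiedge is an edge with only one endpoint; it contributes one to the degree of its endpoint, and in a plane embedding a semiedge with endpoint $v$ drawn inside a face $f$ contributes one to the size of $f$. A $(0,3,6)$-fullerene is a cubic plane graph, possibly with semiedges, all of whose faces have size $3$ or $6$. The dual of a plane graph with semiedges is the usual plane dual, extended so that every semiedge incident with vertex $v$ and face $f$ corresponds to a semiedge of the dual incident with the dual vertex $f^*$ and lying in the dual face $v^*$. -}

module Defs where

open import Data.Nat as ℕ using (ℕ; zero; suc; _<_)
open import Data.Fin as Fin using (Fin)
open import Data.Integer as ℤ using (ℤ; 0ℤ)
open import Data.Bool using (Bool; true; false)
open import Data.Product using (Σ; ∃; _×_; _,_)
open import Data.Sum using (_⊎_)
open import Data.List using (length; filter; allFin)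
open import Data.List.Base using ()
open import Data.Fin.Base using ()
open import Data.List using (List)
open import Data.Vec.Functional using ()
open import Relation.Binary.PropositionalEquality using (_≡_; _≢_)
open import Function using (_∘_)

iter : ∀ {n} → (Fin n → Fin n) → ℕ → Fin n → Fin n
iter f zero    x = x
iter f (suc k) x = f (iter f k x)

SameOrbit : ∀ {n} → (Fin n → Fin n) → Fin n → Fin n → Set
SameOrbit f d e = ∃ λ k → iter f k d ≡ e

OrbitSize : ∀ {n} → (Fin n → Fin n) → Fin n → ℕ → Set
OrbitSize f d k =
  (0 < k) × (iter f k d ≡ d) × (∀ j → 0 < j → j < k → iter f j d ≢ d)

HasOrbitCount : ∀ {n} → (Fin n → Fin n) → ℕ → Set
HasOrbitCount {n} f k =
  Σ (Fin n → Fin k) λ c →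
    (∀ i → ∃ λ d → c d ≡ i) ×
    (∀ d e → c d ≡ c e → SameOrbit f d e) ×
    (∀ d e → SameOrbit f d e → c d ≡ c e)

-- Combinatorial maps with semiedges (darts = Fin n).
-- σ : rotation of darts around their vertex (a permutation),
-- α : involution; its 2-cycles are edges, its fixed points are semiedges.
-- Faces are the orbits of φ = σ ∘ α.

record Map : Set where
  field
    n       : ℕ
    σ       : Fin n → Fin n
    σ⁻¹     : Fin n → Fin n
    σσ⁻¹    : ∀ d → σ (σ⁻¹ d) ≡ d
    σ⁻¹σ    : ∀ d → σ⁻¹ (σ d) ≡ d
    α       : Fin n → Fin n
    αα      : ∀ d → α (α d) ≡ d

open Map public

φ : (M : Map) → Fin (n M) → Fin (n M)
φ M = σ M ∘ α M

semiedgeCount : Map → ℕ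
semiedgeCount M = length (filter (λ d → α M d Fin.≟ d) (allFin (n M)))

data Reach (M : Map) : Fin (n M) → Fin (n M) → Set where
  here  : ∀ {d} → Reach M d d
  viaσ  : ∀ {d e} → Reach M (σ M d) e → Reach M d e
  viaα  : ∀ {d e} → Reach M (α M d) e → Reach M d e

-- plane (spherical) map: connected, V - E + F = 2 where E counts
-- ordinary edges (2-cycles of α); semiedges do not affect the topology.
record Plane (M : Map) : Set where
  field
    connected : ∀ d e → Reach M d e
    V E F     : ℕ
    vertices  : HasOrbitCount (σ M) V
    faces     : HasOrbitCount (φ M) F
    edges     : 2 ℕ.* E ℕ.+ semiedgeCount M ≡ n M
    euler     : V ℕ.+ F ≡ 2 ℕ.+ E

record Fullerene036 (M : Map) : Set where
  field
    plane : Plane M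
    cubic : ∀ d → OrbitSize (σ M) d 3
    faceSizes : ∀ d → OrbitSize (φ M) d 3 ⊎ OrbitSize (φ M) d 6

dual : Map → Map
dual M = record
  { n = n M
  ; σ = σ M ∘ α M
  ; σ⁻¹ = α M ∘ σ⁻¹ M
  ; σσ⁻¹ = λ d → Eq.trans (Eq.cong (σ M) (αα M (σ⁻¹ M d))) (σσ⁻¹ M d)
  ; σ⁻¹σ = λ d → Eq.trans (Eq.cong (α M) (σ⁻¹σ M (α M d))) (αα M d)
  ; α = α M
  ; αα = αα M
  }
  where import Relation.Binary.PropositionalEquality as Eq

record Iso (M N : Map) : Set where
  field
    to   : Fin (n M) → Fin (n N)
    from : Fin (n N) → Fin (n M)
    to-from : ∀ x → to (from x) ≡ x
    from-to : ∀ x → from (to x) ≡ x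
    to-σ : ∀ d → to (σ M d) ≡ σ N (to d)
    to-α : ∀ d → to (α M d) ≡ α N (to d)

-- Points are written in the basis a, b
-- (unit vectors at angle π/3, b = a rotated counterclockwise),
-- so gridpoints are ℤ × ℤ. A dart of T is a gridpoint with one of the
-- six directions, numbered counterclockwise.

Pt : Set
Pt = ℤ × ℤ

_⊕_ : Pt → Pt → Pt
(x₁ , y₁) ⊕ (x₂ , y₂) = (x₁ ℤ.+ x₂ , y₁ ℤ.+ y₂)

_⊖_ : Pt → Pt → Pt
(x₁ , y₁) ⊖ (x₂ , y₂) = (x₁ ℤ.- x₂ , y₁ ℤ.- y₂)

_·_ : ℤ → Pt → Pt
k · (x , y) = (k ℤ.* x , k ℤ.* y)

-- twice the Euclidean inner product in the basis a, b  (⟨a,a⟩=⟨b,b⟩=1, ⟨a,b⟩=1/2)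
ip2 : Pt → Pt → ℤ
ip2 (x₁ , y₁) (x₂ , y₂) =
  ℤ.+ 2 ℤ.* x₁ ℤ.* x₂ ℤ.+ ℤ.+ 2 ℤ.* y₁ ℤ.* y₂ ℤ.+ x₁ ℤ.* y₂ ℤ.+ x₂ ℤ.* y₁

det : Pt → Pt → ℤ
det (x₁ , y₁) (x₂ , y₂) = x₁ ℤ.* y₂ ℤ.- y₁ ℤ.* x₂

dirVec : Fin 6 → Pt
dirVec Fin.zero = (ℤ.+ 1 , ℤ.+ 0)
dirVec (Fin.suc Fin.zero) = (ℤ.+ 0 , ℤ.+ 1)
dirVec (Fin.suc (Fin.suc Fin.zero)) = (ℤ.- ℤ.+ 1 , ℤ.+ 1)
dirVec (Fin.suc (Fin.suc (Fin.suc Fin.zero))) = (ℤ.- ℤ.+ 1 , ℤ.+ 0)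
dirVec (Fin.suc (Fin.suc (Fin.suc (Fin.suc Fin.zero)))) = (ℤ.+ 0 , ℤ.- ℤ.+ 1)
dirVec (Fin.suc (Fin.suc (Fin.suc (Fin.suc (Fin.suc Fin.zero))))) = (ℤ.+ 1 , ℤ.- ℤ.+ 1)

rot : Fin 6 → Fin 6
rot Fin.zero = Fin.suc Fin.zero
rot (Fin.suc Fin.zero) = Fin.suc (Fin.suc Fin.zero)
rot (Fin.suc (Fin.suc Fin.zero)) = Fin.suc (Fin.suc (Fin.suc Fin.zero))
rot (Fin.suc (Fin.suc (Fin.suc Fin.zero))) = Fin.suc (Fin.suc (Fin.suc (Fin.suc Fin.zero)))
rot (Fin.suc (Fin.suc (Fin.suc (Fin.suc Fin.zero)))) = Fin.suc (Fin.suc (Fin.suc (Fin.suc (Fin.suc Fin.zero))))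
rot (Fin.suc (Fin.suc (Fin.suc (Fin.suc (Fin.suc Fin.zero))))) = Fin.zero

opp : Fin 6 → Fin 6
opp d = rot (rot (rot d))

Dart : Set
Dart = Pt × Fin 6

σT : Dart → Dart
σT (p , d) = (p , rot d)

αT : Dart → Dart
αT (p , d) = (p ⊕ dirVec d , opp d)

-- A2 = 2A (so A ranges over ½·lattice = gridpoints
-- ∪ edgepoints, covering steps (1) and (2)); B = A + u, C = A + w with
-- u, w lattice vectors (B, C are translated along with A).

record Triangle : Set where
  field
    A2 : Pt
    u  : Pt
    w  : Pt
    nondegenerate : det u w ≢ 0ℤ
    angleA : 0ℤ ℤ.≤ ip2 u w
    angleB : 0ℤ ℤ.≤ ip2 ((ℤ.- ℤ.+ 1) · u) (w ⊖ u)
    angleC : 0ℤ ℤ.≤ ip2 ((ℤ.- ℤ.+ 1) · w) (u ⊖ w)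

open Triangle public

-- The folding group Γ of the triangle: generated by the half-turns about
-- Ā, B̄, C̄ (and A).  Its elements are the translations by Λ = ℤu + ℤw
-- and the half-turns x ↦ 2A − x + λ (λ ∈ Λ).  Folding △ABC into Q
-- identifies the plane modulo Γ, △ABC being a fundamental domain.
Γelt : Set
Γelt = Bool × ℤ × ℤ

act : Triangle → Γelt → Dart → Dart
act t (false , i , j) (p , d) = (p ⊕ ((i · u t) ⊕ (j · w t)) , d)
act t (true  , i , j) (p , d) = ((A2 t ⊖ p) ⊕ ((i · u t) ⊕ (j · w t)) , opp d)

-- G is (isomorphic to) the graph G* drawn on Q: the quotient map from
-- darts of T onto darts of G identifies exactly the Γ-orbits and
-- respects the vertex rotation and the edge involution.
record IsFolding (t : Triangle) (G : Map) : Set where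
  field
    q      : Dart → Fin (n G)
    onto   : ∀ d → ∃ λ x → q x ≡ d
    fibres : ∀ x y → q x ≡ q y → ∃ λ γ → act t γ x ≡ y
    invar  : ∀ γ x → q (act t γ x) ≡ q x
    q-σ    : ∀ x → q (σT x) ≡ σ G (q x)
    q-α    : ∀ x → q (αT x) ≡ α G (q x)

module Submission where

-- The face rotation s = σα of a (0,3,6)-fullerene M and its edge involution a satisfy
-- s⁶ = a² = (sa)³ = 1 (faces have size 3 or 6, and sa = σ), the relations obeyed by rotation
-- about a gridpoint and edge reversal on the darts of the triangular grid T. Fixing a dart e₀
-- therefore develops T onto the dual of M: a map q from the darts of T onto those of M that
-- intertwines these operations. As T is connected, a rigid motion of T is a symmetry of q as soon
-- as it preserves the image of one dart. The translational symmetries form a lattice of full rank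
-- (M is finite), and a Lagrange–Gauss reduced basis u, w spans a triangle with no obtuse angle.
-- Euler's formula rules out a cubic map with only hexagonal faces and no semiedges, so some dart is
-- fixed by s³ or by a, which makes a half-turn a symmetry. Rotations by ±60° or ±120° are not
-- symmetries: each fixes a gridpoint or the centre of a grid triangle, which would force a face of
-- size 1 or 2 or a vertex of degree 1. Hence the fibres of q are exactly the orbits of the folding
-- group Γ.

open import Defs
open import Data.Nat as ℕ using (ℕ; zero; suc; z≤n; s≤s)
open import Data.Nat.DivMod using (_%_; _/_; m≡m%n+[m/n]*n; m%n<n)
import Data.Nat.Properties as ℕP
open import Data.Integer using (ℤ; 0ℤ; +_; -[1+_]; +≤+; _+_; _-_; _*_; -_; _≤_; _<_; _≤?_; ∣_∣)
open import Data.Integer.DivMod using (_/ℕ_; _%ℕ_; a≡a%ℕn+[a/ℕn]*n; n%ℕd<d)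
import Data.Integer.Properties as ℤP
open import Data.Integer.Tactic.RingSolver using (solve-∀)
open import Data.Fin as Fin using (Fin; toℕ)
import Data.Fin.Properties as FP
open import Data.Fin.Patterns using (0F; 1F; 2F; 3F; 4F; 5F)
open import Data.Product using (Σ; ∃; ∃₂; _×_; _,_; proj₁; proj₂; uncurry)
open import Data.Sum using (_⊎_; inj₁; inj₂)
open import Data.Bool using (true; false)
open import Data.Empty using (⊥; ⊥-elim)
open import Relation.Nullary using (¬_; Dec; yes; no)
open import Relation.Nullary.Decidable using (_⊎-dec_)
open import Relation.Binary.Definitions using (tri<; tri≈; tri>)
open import Relation.Binary.Construct.Closure.ReflexiveTransitive
  using (Star; ε; _◅_; _◅◅_; return; reverse; concat)
open import Relation.Binary.PropositionalEquality
open import Data.List using (length; allFin)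
open import Data.List.Properties using (filter-none)
import Data.List.Relation.Unary.All as All

_^_ : {A : Set} → (A → A) → ℕ → A → A
(f ^ zero)  x = x
(f ^ suc k) x = f ((f ^ k) x)

^-comm : {A : Set} (f : A → A) → ∀ k x → (f ^ k) (f x) ≡ f ((f ^ k) x)
^-comm f zero    x = refl
^-comm f (suc k) x = cong f (^-comm f k x)

^-natural : {A B : Set} {f : A → A} {g : B → B} (h : A → B) →
  (∀ x → h (f x) ≡ g (h x)) → ∀ k x → h ((f ^ k) x) ≡ (g ^ k) (h x)
^-natural h hf zero    x = refl
^-natural {g = g} h hf (suc k) x = trans (hf _) (cong g (^-natural h hf k x))

record Invertible (X : Set) : Set where
  field
    g g⁻¹   : X → X
    g-g⁻¹   : ∀ x → g (g⁻¹ x) ≡ x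
    g⁻¹-g   : ∀ x → g⁻¹ (g x) ≡ x

module _ {X : Set} (G : Invertible X) where
  open Invertible G

  power : ℤ → X → X
  power (+ n)    = g ^ n
  power -[1+ n ] = g⁻¹ ^ suc n

  power-suc : ∀ k x → power (+ 1 + k) x ≡ g (power k x)
  power-suc (+ n)        x = refl
  power-suc -[1+ zero ]  x = sym (g-g⁻¹ x)
  power-suc -[1+ suc n ] x = sym (g-g⁻¹ _)

  power-pred : ∀ k x → power (-[1+ 0 ] + k) x ≡ g⁻¹ (power k x)
  power-pred (+ zero)  x = refl
  power-pred (+ suc n) x = sym (g⁻¹-g _)
  power-pred -[1+ n ]  x = refl

  commute-inverse : ∀ f → (∀ x → f (g x) ≡ g (f x)) → ∀ x → f (g⁻¹ x) ≡ g⁻¹ (f x)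
  commute-inverse f fg x =
    trans (sym (g⁻¹-g (f (g⁻¹ x)))) (cong g⁻¹ (trans (sym (fg (g⁻¹ x))) (cong f (g-g⁻¹ x))))

  power-natural : ∀ f → (∀ x → f (g x) ≡ g (f x)) → ∀ k x → f (power k x) ≡ power k (f x)
  power-natural f fg (+ n)    = ^-natural {f = g} {g = g} f fg n
  power-natural f fg -[1+ n ] = ^-natural {f = g⁻¹} {g = g⁻¹} f (commute-inverse f fg) (suc n)

-≡⇒≡+ : ∀ {a b c} → a - c ≡ b → a ≡ b + c
-≡⇒≡+ {a} {c = c} refl = lemma a c
  where
  lemma : ∀ a c → a ≡ a - c + c
  lemma = solve-∀

≡+⇒-≡ : ∀ {a b c} → a ≡ b + c → a - c ≡ b
≡+⇒-≡ {b = b} {c} refl = lemma b c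
  where
  lemma : ∀ b c → b + c - c ≡ b
  lemma = solve-∀

-- The triangular grid

origin : Pt
origin = (0ℤ , 0ℤ)

infix 30 -ₚ_
-ₚ_ : Pt → Pt
-ₚ (x , y) = (- x , - y)

rot60 : Pt → Pt
rot60 (x , y) = (- y , x + y)

rotate : ℕ → Pt → Pt
rotate = rot60 ^_

rot60-⊕ : ∀ p r → rot60 (p ⊕ r) ≡ rot60 p ⊕ rot60 r
rot60-⊕ (a , b) (c , d) = cong₂ _,_ (ℤP.neg-distrib-+ b d) (lemma a b c d)
  where
  lemma : ∀ a b c d → a + c + (b + d) ≡ a + b + (c + d)
  lemma = solve-∀

rot60-dirVec : ∀ d → rot60 (dirVec d) ≡ dirVec (rot d)
rot60-dirVec 0F = refl
rot60-dirVec 1F = refl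
rot60-dirVec 2F = refl
rot60-dirVec 3F = refl
rot60-dirVec 4F = refl
rot60-dirVec 5F = refl

rotate-⊕ : ∀ k p r → rotate k (p ⊕ r) ≡ rotate k p ⊕ rotate k r
rotate-⊕ zero    p r = refl
rotate-⊕ (suc k) p r = trans (cong rot60 (rotate-⊕ k p r)) (rot60-⊕ (rotate k p) (rotate k r))

rotate-dirVec : ∀ k d → rotate k (dirVec d) ≡ dirVec ((rot ^ k) d)
rotate-dirVec k d = sym (^-natural dirVec (λ d → sym (rot60-dirVec d)) k d)

⊕-identityˡ : ∀ p → origin ⊕ p ≡ p
⊕-identityˡ (x , y) = cong₂ _,_ (ℤP.+-identityˡ x) (ℤP.+-identityˡ y)

⊕-inverseˡ : ∀ p → (-ₚ p) ⊕ p ≡ origin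
⊕-inverseˡ (x , y) = cong₂ _,_ (ℤP.+-inverseˡ x) (ℤP.+-inverseˡ y)

⊕-swapʳ : ∀ p r t → (p ⊕ r) ⊕ t ≡ (p ⊕ t) ⊕ r
⊕-swapʳ (a , b) (c , d) (e , f) = cong₂ _,_ (lemma a c e) (lemma b d f)
  where
  lemma : ∀ a c e → a + c + e ≡ a + e + c
  lemma = solve-∀

rotate³ : ∀ p → rotate 3 p ≡ -ₚ p
rotate³ (x , y) = cong₂ _,_ (lemma₁ x y) (lemma₂ x y)
  where
  lemma₁ : ∀ x y → - (- y + (x + y)) ≡ - x
  lemma₁ = solve-∀
  lemma₂ : ∀ x y → - (x + y) + (- y + (x + y)) ≡ - y
  lemma₂ = solve-∀

⊕-cancelˡ : ∀ p r → (-ₚ p) ⊕ (p ⊕ r) ≡ r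
⊕-cancelˡ (x , y) (r₁ , r₂) = cong₂ _,_ (lemma x r₁) (lemma y r₂)
  where
  lemma : ∀ x r → - x + (x + r) ≡ r
  lemma = solve-∀

opp-rot : ∀ d → opp (rot d) ≡ rot (opp d)
opp-rot 0F = refl
opp-rot 1F = refl
opp-rot 2F = refl
opp-rot 3F = refl
opp-rot 4F = refl
opp-rot 5F = refl

opp-involutive : ∀ d → opp (opp d) ≡ d
opp-involutive 0F = refl
opp-involutive 1F = refl
opp-involutive 2F = refl
opp-involutive 3F = refl
opp-involutive 4F = refl
opp-involutive 5F = refl

rot⁶ : ∀ d → (rot ^ 6) d ≡ d
rot⁶ 0F = refl
rot⁶ 1F = refl
rot⁶ 2F = refl
rot⁶ 3F = refl
rot⁶ 4F = refl
rot⁶ 5F = refl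

rot^toℕ : ∀ d → (rot ^ toℕ d) 0F ≡ d
rot^toℕ 0F = refl
rot^toℕ 1F = refl
rot^toℕ 2F = refl
rot^toℕ 3F = refl
rot^toℕ 4F = refl
rot^toℕ 5F = refl

dirVec-opp : ∀ d → dirVec (opp d) ≡ -ₚ dirVec d
dirVec-opp 0F = refl
dirVec-opp 1F = refl
dirVec-opp 2F = refl
dirVec-opp 3F = refl
dirVec-opp 4F = refl
dirVec-opp 5F = refl

turns : Fin 6 → Fin 6 → Fin 6
turns d d' = (rot ^ (6 ℕ.∸ toℕ d)) d'

rot^turns : ∀ d d' → (rot ^ toℕ (turns d d')) d ≡ d'
rot^turns 0F = λ { 0F → refl ; 1F → refl ; 2F → refl ; 3F → refl ; 4F → refl ; 5F → refl }
rot^turns 1F = λ { 0F → refl ; 1F → refl ; 2F → refl ; 3F → refl ; 4F → refl ; 5F → refl }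
rot^turns 2F = λ { 0F → refl ; 1F → refl ; 2F → refl ; 3F → refl ; 4F → refl ; 5F → refl }
rot^turns 3F = λ { 0F → refl ; 1F → refl ; 2F → refl ; 3F → refl ; 4F → refl ; 5F → refl }
rot^turns 4F = λ { 0F → refl ; 1F → refl ; 2F → refl ; 3F → refl ; 4F → refl ; 5F → refl }
rot^turns 5F = λ { 0F → refl ; 1F → refl ; 2F → refl ; 3F → refl ; 4F → refl ; 5F → refl }

αT-involutive : ∀ x → αT (αT x) ≡ x
αT-involutive ((a , b) , d) rewrite dirVec-opp d | opp-involutive d =
  cong (_, d) (cong₂ _,_ (lemma a (proj₁ (dirVec d))) (lemma b (proj₂ (dirVec d))))
  where
  lemma : ∀ a e → a + e + - e ≡ a
  lemma = solve-∀

σT^ : ∀ k p d → (σT ^ k) (p , d) ≡ (p , (rot ^ k) d)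
σT^ zero    p d = refl
σT^ (suc k) p d = cong σT (σT^ k p d)

σT⁶ : ∀ x → (σT ^ 6) x ≡ x
σT⁶ (p , d) = cong (p ,_) (rot⁶ d)

motion : ℕ → Pt → Dart → Dart
motion k v (p , d) = (rotate k p ⊕ v , (rot ^ k) d)

motion-σT : ∀ k v x → motion k v (σT x) ≡ σT (motion k v x)
motion-σT k v (p , d) = cong (_ ,_) (^-comm rot k d)

motion-αT : ∀ k v x → motion k v (αT x) ≡ αT (motion k v x)
motion-αT k v (p , d) = cong₂ _,_
  (trans (cong (_⊕ v) (trans (rotate-⊕ k p (dirVec d)) (cong (rotate k p ⊕_) (rotate-dirVec k d))))
         (⊕-swapʳ (rotate k p) (dirVec ((rot ^ k) d)) v))
  (sym (^-natural opp opp-rot k d))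

-- Rotations of the grid by ±60° fix a gridpoint; by ±120° a gridpoint or the centre of a triangle.

rotation60-fixes : ∀ v → ∃ λ c → motion 1 v (c , 0F) ≡ σT (c , 0F)
rotation60-fixes (v₁ , v₂) = (- v₂ , v₁ + v₂) , cong (_, 1F) (cong₂ _,_ (lemma₁ v₁ v₂) (lemma₂ v₁ v₂))
  where
  lemma₁ : ∀ v₁ v₂ → - (v₁ + v₂) + v₁ ≡ - v₂
  lemma₁ = solve-∀
  lemma₂ : ∀ v₁ v₂ → - v₂ + (v₁ + v₂) + v₂ ≡ v₁ + v₂
  lemma₂ = solve-∀

rotation300-fixes : ∀ v → ∃ λ c → motion 5 v (σT (c , 0F)) ≡ (c , 0F)
rotation300-fixes (v₁ , v₂) = c , cong (_, 0F)
  (trans (cong (λ p → rot60 (rot60 p) ⊕ (v₁ , v₂)) (rotate³ c)) (cong₂ _,_ (lemma₁ v₁ v₂) (lemma₂ v₁ v₂)))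
  where
  c = (v₁ + v₂ , - v₁)
  lemma₁ : ∀ v₁ v₂ → - (- (v₁ + v₂) + - - v₁) + v₁ ≡ v₁ + v₂
  lemma₁ = solve-∀
  lemma₂ : ∀ v₁ v₂ → - - - v₁ + (- (v₁ + v₂) + - - v₁) + v₂ ≡ - v₁
  lemma₂ = solve-∀

-- The residue of v₁ − v₂ mod 3 decides which point the rotation fixes.
rotation120-fixes : ∀ v → ∃ λ z → motion 2 v z ≡ (σT ^ 2) z ⊎ motion 2 v z ≡ (σT ^ 5) (αT z)
rotation120-fixes (v₁ , v₂) =
  subst Fixes (cong (_, v₂) (sym (-≡⇒≡+ (a≡a%ℕn+[a/ℕn]*n (v₁ - v₂) 3))))
        (fixes ((v₁ - v₂) %ℕ 3) ((v₁ - v₂) /ℕ 3) (n%ℕd<d (v₁ - v₂) 3))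
  where
  Fixes : Pt → Set
  Fixes v = ∃ λ z → motion 2 v z ≡ (σT ^ 2) z ⊎ motion 2 v z ≡ (σT ^ 5) (αT z)
  fixes : ∀ r m → r ℕ.< 3 → Fixes ((+ r + m * + 3) + v₂ , v₂)
  fixes 0 m _ = ((m , m + v₂) , 0F) , inj₁ (cong (_, 2F) (cong₂ _,_ (lemma m v₂) (lemma′ m v₂)))
    where
    lemma : ∀ m v₂ → - (m + (m + v₂)) + (+ 0 + m * + 3 + v₂) ≡ m
    lemma = solve-∀
    lemma′ : ∀ m v₂ → - (m + v₂) + (m + (m + v₂)) + v₂ ≡ m + v₂
    lemma′ = solve-∀
  fixes 1 m _ = ((m , m + v₂) , 0F) , inj₂ (cong (_, 2F) (cong₂ _,_ (lemma m v₂) (lemma′ m v₂)))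
    where
    lemma : ∀ m v₂ → - (m + (m + v₂)) + (+ 1 + m * + 3 + v₂) ≡ m + + 1
    lemma = solve-∀
    lemma′ : ∀ m v₂ → - (m + v₂) + (m + (m + v₂)) + v₂ ≡ m + v₂ + + 0
    lemma′ = solve-∀
  fixes 2 m _ = ((m + + 1 , m + v₂) , 1F) , inj₂ (cong (_, 3F) (cong₂ _,_ (lemma m v₂) (lemma′ m v₂)))
    where
    lemma : ∀ m v₂ → - (m + + 1 + (m + v₂)) + (+ 2 + m * + 3 + v₂) ≡ m + + 1 + + 0
    lemma = solve-∀
    lemma′ : ∀ m v₂ → - (m + v₂) + (m + + 1 + (m + v₂)) + v₂ ≡ m + v₂ + + 1
    lemma′ = solve-∀
  fixes (suc (suc (suc r))) m (s≤s (s≤s (s≤s ())))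

rotation240-fixes : ∀ v → ∃ λ z → motion 4 v ((σT ^ 2) z) ≡ z ⊎ motion 4 v z ≡ αT (σT z)
rotation240-fixes (v₁ , v₂) =
  subst Fixes (cong (v₁ ,_) (sym (-≡⇒≡+ (a≡a%ℕn+[a/ℕn]*n (v₂ - v₁) 3))))
        (fixes ((v₂ - v₁) %ℕ 3) ((v₂ - v₁) /ℕ 3) (n%ℕd<d (v₂ - v₁) 3))
  where
  Fixes : Pt → Set
  Fixes v = ∃ λ z → motion 4 v ((σT ^ 2) z) ≡ z ⊎ motion 4 v z ≡ αT (σT z)
  rotate⁴ : ∀ c v → rotate 4 c ⊕ v ≡ rot60 (-ₚ c) ⊕ v
  rotate⁴ c v = cong (λ p → rot60 p ⊕ v) (rotate³ c)
  fixes : ∀ r m → r ℕ.< 3 → Fixes (v₁ , (+ r + m * + 3) + v₁)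
  fixes 0 m _ = ((m + v₁ , m) , 0F) ,
    inj₁ (cong (_, 0F) (trans (rotate⁴ (m + v₁ , m) (v₁ , + 0 + m * + 3 + v₁))
                              (cong₂ _,_ (lemma m v₁) (lemma′ m v₁))))
    where
    lemma : ∀ m v₁ → - - m + v₁ ≡ m + v₁
    lemma = solve-∀
    lemma′ : ∀ m v₁ → - (m + v₁) + - m + (+ 0 + m * + 3 + v₁) ≡ m
    lemma′ = solve-∀
  fixes 1 m _ = ((m + v₁ , m) , 0F) ,
    inj₂ (cong (_, 4F) (trans (rotate⁴ (m + v₁ , m) (v₁ , + 1 + m * + 3 + v₁))
                              (cong₂ _,_ (lemma m v₁) (lemma′ m v₁))))
    where
    lemma : ∀ m v₁ → - - m + v₁ ≡ m + v₁ + + 0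
    lemma = solve-∀
    lemma′ : ∀ m v₁ → - (m + v₁) + - m + (+ 1 + m * + 3 + v₁) ≡ m + + 1
    lemma′ = solve-∀
  fixes 2 m _ = ((m + v₁ , m + + 1) , 5F) ,
    inj₂ (cong (_, 3F) (trans (rotate⁴ (m + v₁ , m + + 1) (v₁ , + 2 + m * + 3 + v₁))
                              (cong₂ _,_ (lemma m v₁) (lemma′ m v₁))))
    where
    lemma : ∀ m v₁ → - - (m + + 1) + v₁ ≡ m + v₁ + + 1
    lemma = solve-∀
    lemma′ : ∀ m v₁ → - (m + v₁) + - (m + + 1) + (+ 2 + m * + 3 + v₁) ≡ m + + 1 + + 0
    lemma′ = solve-∀
  fixes (suc (suc (suc r))) m (s≤s (s≤s (s≤s ())))

data Step : Dart → Dart → Set where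
  σ-step : ∀ x → Step x (σT x)
  α-step : ∀ x → Step x (αT x)

Path : Dart → Dart → Set
Path = Star Step

σ-path : ∀ k x → Path x ((σT ^ k) x)
σ-path zero    x = ε
σ-path (suc k) x = σ-path k x ◅◅ return (σ-step _)

step-reversible : ∀ {x y} → Step x y → Path y x
step-reversible (σ-step x) = subst (Path (σT x)) (trans (^-comm σT 5 x) (σT⁶ x)) (σ-path 5 (σT x))
step-reversible (α-step x) = subst (Path (αT x)) (αT-involutive x) (return (α-step (αT x)))

path-sym : ∀ {x y} → Path x y → Path y x
path-sym xs = concat (reverse step-reversible xs)

translation-path : ∀ v → (∀ p → Path (p , 0F) (p ⊕ v , 0F)) →
  ∀ k p → Path (p , 0F) (p ⊕ (k · v) , 0F)
translation-path v@(v₁ , v₂) unit = path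
  where
  ℕ-path : ∀ n p → Path (p , 0F) (p ⊕ ((+ n) · v) , 0F)
  ℕ-path zero p@(x , y) =
    subst (λ r → Path (p , 0F) (r , 0F)) (cong₂ _,_ (lemma x v₁) (lemma y v₂)) ε
    where
    lemma : ∀ x w → x ≡ x + 0ℤ * w
    lemma = solve-∀
  ℕ-path (suc n) p@(x , y) =
    ℕ-path n p ◅◅ subst (λ r → Path (p ⊕ ((+ n) · v) , 0F) (r , 0F))
                        (cong₂ _,_ (lemma x (+ n) v₁) (lemma y (+ n) v₂))
                        (unit (p ⊕ ((+ n) · v)))
    where
    lemma : ∀ x m w → x + m * w + w ≡ x + (+ 1 + m) * w
    lemma = solve-∀

  path : ∀ k p → Path (p , 0F) (p ⊕ (k · v) , 0F)
  path (+ n)    p = ℕ-path n p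
  path -[1+ n ] p@(x , y) =
    path-sym (subst (λ r → Path (p ⊕ (-[1+ n ] · v) , 0F) (r , 0F))
                    (cong₂ _,_ (lemma x (+ suc n) v₁) (lemma y (+ suc n) v₂))
                    (ℕ-path (suc n) (p ⊕ (-[1+ n ] · v))))
    where
    lemma : ∀ x m w → x + - m * w + m * w ≡ x
    lemma = solve-∀

path-from-origin : ∀ z → Path (origin , 0F) z
path-from-origin ((x , y) , d) =
  translation-path (0ℤ , + 1) b-path y origin
  ◅◅ translation-path (+ 1 , 0ℤ) a-path x _
  ◅◅ subst (Path _) (cong₂ _,_ (cong₂ _,_ (lemma₁ x y) (lemma₂ x y)) (rot^toℕ d))
           (subst (Path _) (σT^ (toℕ d) (x′ , y′) 0F) (σ-path (toℕ d) ((x′ , y′) , 0F)))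
  where
  x′ = 0ℤ + y * 0ℤ + x * + 1
  y′ = 0ℤ + y * + 1 + x * 0ℤ
  a-path : ∀ p → Path (p , 0F) (p ⊕ (+ 1 , 0ℤ) , 0F)
  a-path p = α-step _ ◅ σ-step _ ◅ σ-step _ ◅ σ-step _ ◅ ε
  b-path : ∀ p → Path (p , 0F) (p ⊕ (0ℤ , + 1) , 0F)
  b-path p = σ-step _ ◅ α-step _ ◅ σ-step _ ◅ σ-step _ ◅ ε
  lemma₁ : ∀ x y → 0ℤ + y * 0ℤ + x * + 1 ≡ x
  lemma₁ = solve-∀
  lemma₂ : ∀ x y → 0ℤ + y * + 1 + x * 0ℤ ≡ y
  lemma₂ = solve-∀

path : ∀ x y → Path x y
path x y = path-sym (path-from-origin x) ◅◅ path-from-origin y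

module _ {X : Set} (s a : X → X) where

  record Equivariant (f : Dart → X) : Set where
    field
      σ-equivariant : ∀ x → f (σT x) ≡ s (f x)
      α-equivariant : ∀ x → f (αT x) ≡ a (f x)

  equivariant-unique : ∀ {f g} → Equivariant f → Equivariant g → ∀ {x y} → Path x y → f x ≡ g x → f y ≡ g y
  equivariant-unique ef eg ε                    fx≡gx = fx≡gx
  equivariant-unique ef eg (σ-step x ◅ xs) fx≡gx = equivariant-unique ef eg xs
    (trans (σ-equivariant ef x) (trans (cong s fx≡gx) (sym (σ-equivariant eg x))))
    where open Equivariant
  equivariant-unique ef eg (α-step x ◅ xs) fx≡gx = equivariant-unique ef eg xs
    (trans (α-equivariant ef x) (trans (cong a fx≡gx) (sym (α-equivariant eg x))))
    where open Equivariant

record Automorphism (h : Dart → Dart) : Set where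
  field
    commutes-σT : ∀ x → h (σT x) ≡ σT (h x)
    commutes-αT : ∀ x → h (αT x) ≡ αT (h x)

motion-automorphism : ∀ k v → Automorphism (motion k v)
motion-automorphism k v = record { commutes-σT = motion-σT k v ; commutes-αT = motion-αT k v }

act-automorphism : ∀ t γ → Automorphism (act t γ)
act-automorphism t γ = record { commutes-σT = act-σT γ ; commutes-αT = act-αT γ }
  where
  act-σT : ∀ γ x → act t γ (σT x) ≡ σT (act t γ x)
  act-σT (false , i , j) (p , d) = refl
  act-σT (true  , i , j) (p , d) = cong (_ ,_) (opp-rot d)
  act-αT : ∀ γ x → act t γ (αT x) ≡ αT (act t γ x)
  act-αT (false , i , j) (p , d) = cong (_, opp d) (⊕-swapʳ p (dirVec d) ((i · u t) ⊕ (j · w t)))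
  act-αT (true  , i , j) ((p₁ , p₂) , d) rewrite dirVec-opp d = cong (_, opp (opp d)) (cong₂ _,_
    (lemma (proj₁ (A2 t)) p₁ (proj₁ (dirVec d)) (proj₁ ((i · u t) ⊕ (j · w t))))
    (lemma (proj₂ (A2 t)) p₂ (proj₂ (dirVec d)) (proj₂ ((i · u t) ⊕ (j · w t)))))
    where
    lemma : ∀ c p δ l → c - (p + δ) + l ≡ c - p + l + - δ
    lemma = solve-∀

symmetry-from-dart : ∀ {X} {s a : X → X} {f : Dart → X} → Equivariant s a f →
  ∀ {h} → Automorphism h → ∀ x → f (h x) ≡ f x → ∀ y → f (h y) ≡ f y
symmetry-from-dart {s = s} {a} {f} ef {h} ah x fhx≡fx y = equivariant-unique s a efh ef (path x y) fhx≡fx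
  where
  open Equivariant ef
  open Automorphism ah
  efh : Equivariant s a (λ z → f (h z))
  efh = record
    { σ-equivariant = λ z → trans (cong f (commutes-σT z)) (σ-equivariant (h z))
    ; α-equivariant = λ z → trans (cong f (commutes-αT z)) (α-equivariant (h z)) }

-- Developing an action of ⟨s, a ∣ s⁶, a², (sa)³⟩ onto the grid

module Development {X : Set} (s a : X → X)
  (a² : ∀ x → a (a x) ≡ x) (s⁶ : ∀ x → (s ^ 6) x ≡ x) (sa³ : ∀ x → ((λ y → s (a y)) ^ 3) x ≡ x) where

  open ≡-Reasoning

  s⁵ : X → X
  s⁵ = s ^ 5

  asa≡s⁵as⁵ : ∀ x → a (s (a x)) ≡ s⁵ (a (s⁵ x))
  asa≡s⁵as⁵ x = begin
    a (s (a x))                             ≡⟨ sym (s⁶ _) ⟩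
    s⁵ (s (a (s (a x))))                    ≡⟨ cong (λ z → s⁵ (s (a (s (a z))))) (sym (s⁶ x)) ⟩
    s⁵ (s (a (s (a (s (s⁵ x))))))           ≡⟨ cong (λ z → s⁵ (s (a (s (a (s z)))))) (sym (a² (s⁵ x))) ⟩
    s⁵ (s (a (s (a (s (a (a (s⁵ x))))))))   ≡⟨ cong s⁵ (sa³ (a (s⁵ x))) ⟩
    s⁵ (a (s⁵ x))                           ∎

  s⁵as⁵as≡ass : ∀ x → s⁵ (a (s⁵ (a (s x)))) ≡ a (s (s x))
  s⁵as⁵as≡ass x = trans (sym (asa≡s⁵as⁵ (a (s x)))) (cong (λ z → a (s z)) (a² (s x)))

  sas≡as⁵a : ∀ x → s (a (s x)) ≡ a (s⁵ (a x))
  sas≡as⁵a x = begin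
    s (a (s x))            ≡⟨ cong (λ z → s (a (s z))) (sym (a² x)) ⟩
    s (a (s (a (a x))))    ≡⟨ cong s (asa≡s⁵as⁵ (a x)) ⟩
    s (s⁵ (a (s⁵ (a x))))  ≡⟨ s⁶ _ ⟩
    a (s⁵ (a x))           ∎

  -- images of the steps α σ σ σ and σ α σ σ, which translate the grid along a and b
  τa τa⁻¹ τb τb⁻¹ : X → X
  τa x = s (s (s (a x)))
  τa⁻¹ x = a (s (s (s x)))
  τb x = s (s (a (s x)))
  τb⁻¹ x = s⁵ (a (s (s (s (s x)))))

  τa-τa⁻¹ : ∀ x → τa (τa⁻¹ x) ≡ x
  τa-τa⁻¹ x = trans (cong (λ z → s (s (s z))) (a² _)) (s⁶ x)

  τa⁻¹-τa : ∀ x → τa⁻¹ (τa x) ≡ x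
  τa⁻¹-τa x = trans (cong a (s⁶ _)) (a² x)

  τb-τb⁻¹ : ∀ x → τb (τb⁻¹ x) ≡ x
  τb-τb⁻¹ x = trans (cong (λ z → s (s (a z))) (s⁶ _)) (trans (cong (λ z → s (s z)) (a² _)) (s⁶ x))

  τb⁻¹-τb : ∀ x → τb⁻¹ (τb x) ≡ x
  τb⁻¹-τb x = trans (cong (λ z → s⁵ (a z)) (s⁶ _)) (trans (cong s⁵ (a² _)) (s⁶ x))

  τa-τb : ∀ x → τa (τb x) ≡ τb (τa x)
  τa-τb x = cong (λ z → s (s z)) (begin
    s (a (s (s (a (s x)))))    ≡⟨ sas≡as⁵a _ ⟩
    a (s⁵ (a (s (a (s x)))))   ≡⟨ cong (λ z → a (s⁵ (a z))) (sas≡as⁵a x) ⟩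
    a (s⁵ (a (a (s⁵ (a x)))))  ≡⟨ cong (λ z → a (s⁵ z)) (a² _) ⟩
    a (s⁵ (s⁵ (a x)))          ≡⟨ cong (λ z → a (s (s (s (s z))))) (s⁶ _) ⟩
    a (s (s (s (s (a x)))))    ∎)

  τA τB : Invertible X
  τA = record { g = τa ; g⁻¹ = τa⁻¹ ; g-g⁻¹ = τa-τa⁻¹ ; g⁻¹-g = τa⁻¹-τa }
  τB = record { g = τb ; g⁻¹ = τb⁻¹ ; g-g⁻¹ = τb-τb⁻¹ ; g⁻¹-g = τb⁻¹-τb }

  τa^-τb : ∀ k x → power τA k (τb x) ≡ τb (power τA k x)
  τa^-τb k x = sym (power-natural τA τb (λ x → sym (τa-τb x)) k x)

  τa^-τb⁻¹ : ∀ k x → power τA k (τb⁻¹ x) ≡ τb⁻¹ (power τA k x)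
  τa^-τb⁻¹ k = commute-inverse τB (power τA k) (τa^-τb k)

  translate : Pt → X → X
  translate (x , y) e = power τA x (power τB y e)

  shift : Fin 6 → X → X
  shift 0F = τa
  shift 1F = τb
  shift 2F = λ e → τa⁻¹ (τb e)
  shift 3F = τa⁻¹
  shift 4F = τb⁻¹
  shift 5F = λ e → τa (τb⁻¹ e)

  translate-dirVec : ∀ p d e → translate (p ⊕ dirVec d) e ≡ shift d (translate p e)
  translate-dirVec (x , y) 0F e rewrite ℤP.+-comm x (+ 1) | ℤP.+-identityʳ y =
    power-suc τA x _
  translate-dirVec (x , y) 1F e rewrite ℤP.+-comm y (+ 1) | ℤP.+-identityʳ x =
    trans (cong (power τA x) (power-suc τB y e)) (τa^-τb x _)
  translate-dirVec (x , y) 2F e rewrite ℤP.+-comm y (+ 1) | ℤP.+-comm x -[1+ 0 ] =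
    trans (cong (power τA (-[1+ 0 ] + x)) (power-suc τB y e))
          (trans (power-pred τA x _) (cong τa⁻¹ (τa^-τb x _)))
  translate-dirVec (x , y) 3F e rewrite ℤP.+-comm x -[1+ 0 ] | ℤP.+-identityʳ y =
    power-pred τA x _
  translate-dirVec (x , y) 4F e rewrite ℤP.+-comm y -[1+ 0 ] | ℤP.+-identityʳ x =
    trans (cong (power τA x) (power-pred τB y e)) (τa^-τb⁻¹ x _)
  translate-dirVec (x , y) 5F e rewrite ℤP.+-comm y -[1+ 0 ] | ℤP.+-comm x (+ 1) =
    trans (cong (power τA (+ 1 + x)) (power-pred τB y e))
          (trans (power-suc τA x _) (cong τa (τa^-τb⁻¹ x _)))

  develop : X → Dart → X
  develop e (p , d) = (s ^ toℕ d) (translate p e)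

  module _ (e : X) where

    develop-σ : ∀ x → develop e (σT x) ≡ s (develop e x)
    develop-σ (p , 0F) = refl
    develop-σ (p , 1F) = refl
    develop-σ (p , 2F) = refl
    develop-σ (p , 3F) = refl
    develop-σ (p , 4F) = refl
    develop-σ (p , 5F) = sym (s⁶ _)

    develop-α : ∀ x → develop e (αT x) ≡ a (develop e x)
    develop-α (p , 0F) = trans (cong (s ^ 3) (translate-dirVec p 0F e)) (s⁶ _)
    develop-α (p , 1F) = trans (cong (s ^ 4) (translate-dirVec p 1F e)) (s⁶ _)
    develop-α (p , 2F) = trans (cong s⁵ (translate-dirVec p 2F e)) (s⁵as⁵as≡ass (translate p e))
    develop-α (p , 3F) = translate-dirVec p 3F e
    develop-α (p , 4F) = trans (cong s (translate-dirVec p 4F e)) (s⁶ _)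
    develop-α (p , 5F) = trans (cong (s ^ 2) (translate-dirVec p 5F e)) (s⁵as⁵as≡ass ((s ^ 3) (translate p e)))

    develop-equivariant : Equivariant s a (develop e)
    develop-equivariant = record { σ-equivariant = develop-σ ; α-equivariant = develop-α }

-- Lattices in ℤ²

norm : Pt → ℤ
norm v = ip2 v v

norm-nonneg : ∀ v → 0ℤ ≤ norm v
norm-nonneg (x , y) =
  subst (0ℤ ≤_) (lemma x y)
    (ℤP.+-mono-≤ (ℤP.+-mono-≤ (square-nonneg x) (square-nonneg y)) (square-nonneg (x + y)))
  where
  square-nonneg : ∀ i → 0ℤ ≤ i * i
  square-nonneg (+ zero)  = +≤+ z≤n
  square-nonneg (+ suc n) = +≤+ z≤n
  square-nonneg -[1+ n ]  = +≤+ z≤n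
  lemma : ∀ x y → x * x + y * y + (x + y) * (x + y) ≡ + 2 * x * x + + 2 * y * y + x * y + x * y
  lemma = solve-∀

ip2-comm : ∀ u w → ip2 u w ≡ ip2 w u
ip2-comm (u₁ , u₂) (w₁ , w₂) = lemma u₁ u₂ w₁ w₂
  where
  lemma : ∀ u₁ u₂ w₁ w₂ → + 2 * u₁ * w₁ + + 2 * u₂ * w₂ + u₁ * w₂ + w₁ * u₂
                        ≡ + 2 * w₁ * u₁ + + 2 * w₂ * u₂ + w₁ * u₂ + u₁ * w₂
  lemma = solve-∀

ip2-negʳ : ∀ u w → ip2 u (-ₚ w) ≡ - ip2 u w
ip2-negʳ (u₁ , u₂) (w₁ , w₂) = lemma u₁ u₂ w₁ w₂
  where
  lemma : ∀ u₁ u₂ w₁ w₂ → + 2 * u₁ * - w₁ + + 2 * u₂ * - w₂ + u₁ * - w₂ + - w₁ * u₂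
                        ≡ - (+ 2 * u₁ * w₁ + + 2 * u₂ * w₂ + u₁ * w₂ + w₁ * u₂)
  lemma = solve-∀

norm-neg : ∀ w → norm (-ₚ w) ≡ norm w
norm-neg (w₁ , w₂) = lemma w₁ w₂
  where
  lemma : ∀ w₁ w₂ → + 2 * - w₁ * - w₁ + + 2 * - w₂ * - w₂ + - w₁ * - w₂ + - w₁ * - w₂
                  ≡ + 2 * w₁ * w₁ + + 2 * w₂ * w₂ + w₁ * w₂ + w₁ * w₂
  lemma = solve-∀

norm-⊕ : ∀ u w → norm (w ⊕ u) ≡ norm w + + 2 * ip2 u w + norm u
norm-⊕ (u₁ , u₂) (w₁ , w₂) = lemma u₁ u₂ w₁ w₂
  where
  lemma : ∀ u₁ u₂ w₁ w₂ →
    + 2 * (w₁ + u₁) * (w₁ + u₁) + + 2 * (w₂ + u₂) * (w₂ + u₂) + (w₁ + u₁) * (w₂ + u₂) + (w₁ + u₁) * (w₂ + u₂)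
    ≡ (+ 2 * w₁ * w₁ + + 2 * w₂ * w₂ + w₁ * w₂ + w₁ * w₂)
      + + 2 * (+ 2 * u₁ * w₁ + + 2 * u₂ * w₂ + u₁ * w₂ + w₁ * u₂)
      + (+ 2 * u₁ * u₁ + + 2 * u₂ * u₂ + u₁ * u₂ + u₁ * u₂)
  lemma = solve-∀

norm-⊖ : ∀ u w → norm (w ⊕ -ₚ u) ≡ norm w - + 2 * ip2 u w + norm u
norm-⊖ u w = begin
  norm (w ⊕ -ₚ u)                             ≡⟨ norm-⊕ (-ₚ u) w ⟩
  norm w + + 2 * ip2 (-ₚ u) w + norm (-ₚ u)   ≡⟨ cong₂ (λ i n → norm w + + 2 * i + n) ip2-neg (norm-neg u) ⟩
  norm w + + 2 * - ip2 u w + norm u           ≡⟨ cong (λ i → norm w + i + norm u) (sym (ℤP.neg-distribʳ-* (+ 2) _)) ⟩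
  norm w - + 2 * ip2 u w + norm u             ∎
  where
  open ≡-Reasoning
  ip2-neg : ip2 (-ₚ u) w ≡ - ip2 u w
  ip2-neg = trans (ip2-comm (-ₚ u) w) (trans (ip2-negʳ w u) (cong -_ (ip2-comm w u)))

ip2-corner : ∀ u w → ip2 ((- + 1) · u) (w ⊖ u) ≡ norm u - ip2 u w
ip2-corner (u₁ , u₂) (w₁ , w₂) = lemma u₁ u₂ w₁ w₂
  where
  lemma : ∀ u₁ u₂ w₁ w₂ →
    + 2 * (- + 1 * u₁) * (w₁ - u₁) + + 2 * (- + 1 * u₂) * (w₂ - u₂)
      + (- + 1 * u₁) * (w₂ - u₂) + (w₁ - u₁) * (- + 1 * u₂)
    ≡ (+ 2 * u₁ * u₁ + + 2 * u₂ * u₂ + u₁ * u₂ + u₁ * u₂) - (+ 2 * u₁ * w₁ + + 2 * u₂ * w₂ + u₁ * w₂ + w₁ * u₂)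
  lemma = solve-∀

Reduced : Pt → Pt → Set
Reduced u w = (+ 2 * ip2 u w ≤ norm u) × (- norm u ≤ + 2 * ip2 u w) × (norm u ≤ norm w)

NonObtuse : Pt → Pt → Set
NonObtuse u w = (0ℤ ≤ ip2 u w) × (0ℤ ≤ ip2 ((- + 1) · u) (w ⊖ u)) × (0ℤ ≤ ip2 ((- + 1) · w) (u ⊖ w))

reduced-neg : ∀ {u w} → Reduced u w → Reduced u (-ₚ w)
reduced-neg {u} {w} (2ip≤u , -u≤2ip , u≤w) =
  subst₂ _≤_ (sym 2ip′≡) (ℤP.neg-involutive (norm u)) (ℤP.neg-mono-≤ -u≤2ip) ,
  subst (- norm u ≤_) (sym 2ip′≡) (ℤP.neg-mono-≤ 2ip≤u) ,
  subst (norm u ≤_) (sym (norm-neg w)) u≤w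
  where
  2ip′≡ : + 2 * ip2 u (-ₚ w) ≡ - (+ 2 * ip2 u w)
  2ip′≡ = trans (cong (+ 2 *_) (ip2-negʳ u w)) (sym (ℤP.neg-distribʳ-* (+ 2) (ip2 u w)))

reduced⇒nonObtuse : ∀ {u w} → 0ℤ ≤ ip2 u w → Reduced u w → NonObtuse u w
reduced⇒nonObtuse {u} {w} 0≤ip (2ip≤u , _ , u≤w) =
  0≤ip ,
  subst (0ℤ ≤_) (sym (ip2-corner u w)) (ℤP.i≤j⇒0≤j-i ip≤u) ,
  subst (0ℤ ≤_) (sym (trans (ip2-corner w u) (cong (λ t → norm w - t) (ip2-comm w u))))
        (ℤP.i≤j⇒0≤j-i (ℤP.≤-trans ip≤u u≤w))
  where
  double : ∀ c → c + c ≡ + 2 * c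
  double = solve-∀
  ip≤u : ip2 u w ≤ norm u
  ip≤u = ℤP.≤-trans (subst₂ _≤_ (ℤP.+-identityʳ _) (double _) (ℤP.+-monoʳ-≤ (ip2 u w) 0≤ip)) 2ip≤u

∣norm∣-mono-< : ∀ {v w} → norm v < norm w → ∣ norm v ∣ ℕ.< ∣ norm w ∣
∣norm∣-mono-< {v} {w} lt = ℤP.drop‿+<+
  (subst₂ _<_ (sym (ℤP.0≤i⇒+∣i∣≡i (norm-nonneg v))) (sym (ℤP.0≤i⇒+∣i∣≡i (norm-nonneg w))) lt)

Minimal : (ℕ → Set) → ℕ → Set
Minimal Q k = ∀ j → j ℕ.< k → ¬ Q j

module _ {Q : ℕ → Set} (Q? : ∀ k → Dec (Q k)) where

  least-below : ∀ n → (∃ λ k → k ℕ.< n × Q k × Minimal Q k) ⊎ (∀ j → j ℕ.< n → ¬ Q j)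
  least-below zero = inj₂ (λ j ())
  least-below (suc n) with least-below n
  ... | inj₁ (k , k<n , qk , min) = inj₁ (k , ℕP.m<n⇒m<1+n k<n , qk , min)
  ... | inj₂ none with Q? n
  ...   | yes qn = inj₁ (n , ℕP.n<1+n n , qn , none)
  ...   | no ¬qn = inj₂ none′
    where
    none′ : ∀ j → j ℕ.< suc n → ¬ Q j
    none′ j (s≤s j≤n) with ℕP.m≤n⇒m<n∨m≡n j≤n
    ... | inj₁ j<n  = none j j<n
    ... | inj₂ refl = ¬qn

  least : ∀ {n} → Q n → ∃ λ k → Q k × Minimal Q k
  least {n} qn with least-below (suc n)
  ... | inj₁ (k , _ , qk , min) = k , qk , min
  ... | inj₂ none = ⊥-elim (none n (ℕP.n<1+n n) qn)

record IsSubgroup (P : Pt → Set) : Set where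
  field
    ∈-origin : P origin
    ∈-⊕      : ∀ {v w} → P v → P w → P (v ⊕ w)
    ∈-neg    : ∀ {v} → P v → P (-ₚ v)

module Lattice {P : Pt → Set} (P? : ∀ v → Dec (P v)) (subgroup : IsSubgroup P) where

  open IsSubgroup subgroup

  ∈-scale : ∀ k {v} → P v → P (k · v)
  ∈-scale (+ n) {v@(x , y)} pv = ℕ-scale n
    where
    ℕ-scale : ∀ n → P ((+ n) · v)
    ℕ-scale zero    = subst P (cong₂ _,_ (sym (ℤP.*-zeroˡ x)) (sym (ℤP.*-zeroˡ y))) ∈-origin
    ℕ-scale (suc n) = subst P (cong₂ _,_ (lemma (+ n) x) (lemma (+ n) y)) (∈-⊕ pv (ℕ-scale n))
      where
      lemma : ∀ m x → x + m * x ≡ (+ 1 + m) * x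
      lemma = solve-∀
  ∈-scale -[1+ n ] {x , y} pv =
    subst P (cong₂ _,_ (ℤP.neg-distribˡ-* (+ suc n) x) (ℤP.neg-distribˡ-* (+ suc n) y))
          (∈-neg (∈-scale (+ suc n) pv))

  record Basis (u w : Pt) : Set where
    field
      ∈u          : P u
      ∈w          : P w
      independent : det u w ≢ 0ℤ
      spans       : ∀ v → P v → ∃₂ λ i j → v ≡ (i · u) ⊕ (j · w)

  -- Division with remainder by the two basis vectors leaves a period in the box, hence the origin.
  triangular-basis : ∀ {g r h} → P (+ suc g , 0ℤ) → P (+ r , + suc h) →
    (∀ {x y} → x ℕ.< suc g → y ℕ.< suc h → P (+ x , + y) → x ≡ 0 × y ≡ 0) →
    Basis (+ suc g , 0ℤ) (+ r , + suc h)
  triangular-basis {g} {r} {h} ∈u ∈w box = record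
    { ∈u = ∈u ; ∈w = ∈w ; independent = λ () ; spans = spans }
    where
    b₁ = (+ suc g , 0ℤ)
    b₂ = (+ r , + suc h)
    spans : ∀ v → P v → ∃₂ λ i j → v ≡ (i · b₁) ⊕ (j · b₂)
    spans (v₁ , v₂) pv = i , j , cong₂ _,_ (v₁≡ (proj₁ rem≡0)) (v₂≡ (proj₂ rem≡0))
      where
      j = v₂ /ℕ suc h
      r₂ = v₂ %ℕ suc h
      x = v₁ - j * + r
      i = x /ℕ suc g
      r₁ = x %ℕ suc g
      remainder : ((v₁ , v₂) ⊕ -ₚ (j · b₂)) ⊕ -ₚ (i · b₁) ≡ (+ r₁ , + r₂)
      remainder = cong₂ _,_ (≡+⇒-≡ (a≡a%ℕn+[a/ℕn]*n x (suc g)))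
        (trans (lemma v₂ j (+ suc h) i) (≡+⇒-≡ (a≡a%ℕn+[a/ℕn]*n v₂ (suc h))))
        where
        lemma : ∀ v j h i → v + - (j * h) + - (i * 0ℤ) ≡ v - j * h
        lemma = solve-∀
      rem≡0 = box (n%ℕd<d x (suc g)) (n%ℕd<d v₂ (suc h))
                 (subst P remainder (∈-⊕ (∈-⊕ pv (∈-neg (∈-scale j ∈w))) (∈-neg (∈-scale i ∈u))))
      v₁≡ : r₁ ≡ 0 → v₁ ≡ i * + suc g + j * + r
      v₁≡ r₁≡0 = -≡⇒≡+ {b = i * + suc g} (trans (a≡a%ℕn+[a/ℕn]*n x (suc g))
                              (trans (cong (λ t → + t + i * + suc g) r₁≡0) (ℤP.+-identityˡ _)))
      v₂≡ : r₂ ≡ 0 → v₂ ≡ i * 0ℤ + j * + suc h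
      v₂≡ r₂≡0 = trans (a≡a%ℕn+[a/ℕn]*n v₂ (suc h))
                      (trans (cong (λ t → + t + j * + suc h) r₂≡0)
                             (cong (_+ j * + suc h) (sym (ℤP.*-zeroʳ i))))

  -- Hermite normal form: 1 + g is the least positive period on the first axis, and 1 + h the least
  -- positive height of a period.
  axes-basis : ∀ {m n} → P (+ suc m , 0ℤ) → P (0ℤ , + suc n) → ∃₂ Basis
  axes-basis ∈a ∈b with least (λ k → P? (+ suc k , 0ℤ)) ∈a
  ... | g , ∈u , g-min with least (λ k → FP.any? (λ (x : Fin (suc g)) → P? (+ toℕ x , + suc k))) (0F , ∈b)
  ...   | h , (r , ∈w) , h-min = _ , _ , triangular-basis ∈u ∈w box
    where
    box : ∀ {x y} → x ℕ.< suc g → y ℕ.< suc h → P (+ x , + y) → x ≡ 0 × y ≡ 0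
    box {zero}  {zero}  _ _ _ = refl , refl
    box {suc x} {zero}  (s≤s x<g) _ pxy = ⊥-elim (g-min x x<g pxy)
    box {x}     {suc y} x<g (s≤s y<h) pxy =
      ⊥-elim (h-min y y<h (Fin.fromℕ< x<g , subst (λ t → P (+ t , + suc y)) (sym (FP.toℕ-fromℕ< x<g)) pxy))

  module _ {u w : Pt} (b : Basis u w) where
    open Basis b

    private
      u₁ = proj₁ u
      u₂ = proj₂ u
      w₁ = proj₁ w
      w₂ = proj₂ w

      change-basis : ∀ {u′ w′} → P u′ → P w′ → (det u w ≡ det u′ w′ ⊎ - det u w ≡ det u′ w′) →
        (∀ i j → ∃₂ λ i′ j′ → (i · u) ⊕ (j · w) ≡ (i′ · u′) ⊕ (j′ · w′)) → Basis u′ w′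
      change-basis {u′} {w′} ∈u′ ∈w′ det≡ coords = record
        { ∈u = ∈u′ ; ∈w = ∈w′
        ; independent = λ d≡0 → independent (case det≡ d≡0)
        ; spans = λ v pv → let (i , j , v≡) = spans v pv ; (i′ , j′ , eq) = coords i j
                           in i′ , j′ , trans v≡ eq }
        where
        case : (det u w ≡ det u′ w′ ⊎ - det u w ≡ det u′ w′) → det u′ w′ ≡ 0ℤ → det u w ≡ 0ℤ
        case (inj₁ e) d≡0 = trans e d≡0
        case (inj₂ e) d≡0 = trans (sym (ℤP.neg-involutive _)) (cong -_ (trans e d≡0))

    basis-⊕ : Basis u (w ⊕ u)
    basis-⊕ = change-basis ∈u (∈-⊕ ∈w ∈u) (inj₁ (lemma₁ u₁ u₂ w₁ w₂))
      (λ i j → i - j , j , cong₂ _,_ (lemma₂ i j u₁ w₁) (lemma₂ i j u₂ w₂))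
      where
      lemma₁ : ∀ u₁ u₂ w₁ w₂ → u₁ * w₂ - u₂ * w₁ ≡ u₁ * (w₂ + u₂) - u₂ * (w₁ + u₁)
      lemma₁ = solve-∀
      lemma₂ : ∀ i j u w → i * u + j * w ≡ (i - j) * u + j * (w + u)
      lemma₂ = solve-∀

    basis-⊖ : Basis u (w ⊕ -ₚ u)
    basis-⊖ = change-basis ∈u (∈-⊕ ∈w (∈-neg ∈u)) (inj₁ (lemma₁ u₁ u₂ w₁ w₂))
      (λ i j → i + j , j , cong₂ _,_ (lemma₂ i j u₁ w₁) (lemma₂ i j u₂ w₂))
      where
      lemma₁ : ∀ u₁ u₂ w₁ w₂ → u₁ * w₂ - u₂ * w₁ ≡ u₁ * (w₂ + - u₂) - u₂ * (w₁ + - u₁)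
      lemma₁ = solve-∀
      lemma₂ : ∀ i j u w → i * u + j * w ≡ (i + j) * u + j * (w + - u)
      lemma₂ = solve-∀

    basis-swap : Basis w u
    basis-swap = change-basis ∈w ∈u (inj₂ (lemma₁ u₁ u₂ w₁ w₂))
      (λ i j → j , i , cong₂ _,_ (ℤP.+-comm (i * u₁) (j * w₁)) (ℤP.+-comm (i * u₂) (j * w₂)))
      where
      lemma₁ : ∀ u₁ u₂ w₁ w₂ → - (u₁ * w₂ - u₂ * w₁) ≡ w₁ * u₂ - w₂ * u₁
      lemma₁ = solve-∀

    basis-neg : Basis u (-ₚ w)
    basis-neg = change-basis ∈u (∈-neg ∈w) (inj₂ (lemma₁ u₁ u₂ w₁ w₂))
      (λ i j → i , - j , cong₂ _,_ (lemma₂ i j u₁ w₁) (lemma₂ i j u₂ w₂))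
      where
      lemma₁ : ∀ u₁ u₂ w₁ w₂ → - (u₁ * w₂ - u₂ * w₁) ≡ u₁ * - w₂ - u₂ * - w₁
      lemma₁ = solve-∀
      lemma₂ : ∀ i j u w → i * u + j * w ≡ i * u + - j * - w
      lemma₂ = solve-∀

  ReducedBasis : Set
  ReducedBasis = ∃₂ λ u w → Basis u w × Reduced u w

  -- Lagrange–Gauss reduction; each step strictly decreases |u|² + |w|², which the fuel bounds.
  reduce : ∀ fuel {u w} → ∣ norm u ∣ ℕ.+ ∣ norm w ∣ ℕ.< fuel → norm u ≤ norm w → Basis u w → ReducedBasis
  reorder : ∀ fuel {u w w′} → ∣ norm u ∣ ℕ.+ ∣ norm w ∣ ℕ.< suc fuel → norm w′ < norm w → Basis u w′ →
    ReducedBasis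

  reduce (suc fuel) {u} {w} size< u≤w b with + 2 * ip2 u w ≤? norm u | - norm u ≤? + 2 * ip2 u w
  ... | yes ≤u | yes -u≤ = u , w , b , ≤u , -u≤ , u≤w
  ... | no  ≰u | _       = reorder fuel {w = w} size<
    (subst (_< norm w) (sym (norm-⊖ u w)) (shorter (ℤP.≰⇒> ≰u))) (basis-⊖ b)
    where
    shorter : norm u < + 2 * ip2 u w → norm w - + 2 * ip2 u w + norm u < norm w
    shorter lt = subst₂ _<_ (lemma₁ (norm w) (+ 2 * ip2 u w) (norm u)) (lemma₂ (norm w) (+ 2 * ip2 u w))
                            (ℤP.+-monoˡ-< (norm w - + 2 * ip2 u w) lt)
      where
      lemma₁ : ∀ n c m → m + (n - c) ≡ n - c + m
      lemma₁ = solve-∀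
      lemma₂ : ∀ n c → c + (n - c) ≡ n
      lemma₂ = solve-∀
  ... | yes _  | no ≰2ip = reorder fuel {w = w} size<
    (subst (_< norm w) (sym (norm-⊕ u w)) (shorter (ℤP.≰⇒> ≰2ip))) (basis-⊕ b)
    where
    shorter : + 2 * ip2 u w < - norm u → norm w + + 2 * ip2 u w + norm u < norm w
    shorter lt = subst₂ _<_ (lemma₁ (norm w) (+ 2 * ip2 u w) (norm u)) (lemma₂ (norm w) (norm u))
                            (ℤP.+-monoˡ-< (norm w + norm u) lt)
      where
      lemma₁ : ∀ n c m → c + (n + m) ≡ n + c + m
      lemma₁ = solve-∀
      lemma₂ : ∀ n m → - m + (n + m) ≡ n
      lemma₂ = solve-∀

  reorder fuel {u} {w} {w′} size< w′<w b with norm u ≤? norm w′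
  ... | yes u≤w′ = reduce fuel smaller u≤w′ b
    where
    smaller : ∣ norm u ∣ ℕ.+ ∣ norm w′ ∣ ℕ.< fuel
    smaller = ℕP.<-≤-trans (ℕP.+-monoʳ-< ∣ norm u ∣ (∣norm∣-mono-< {w′} {w} w′<w)) (ℕP.≤-pred size<)
  ... | no  u≰w′ = reduce fuel smaller (ℤP.<⇒≤ (ℤP.≰⇒> u≰w′)) (basis-swap b)
    where
    smaller : ∣ norm w′ ∣ ℕ.+ ∣ norm u ∣ ℕ.< fuel
    smaller = subst (ℕ._< fuel) (ℕP.+-comm ∣ norm u ∣ ∣ norm w′ ∣)
      (ℕP.<-≤-trans (ℕP.+-monoʳ-< ∣ norm u ∣ (∣norm∣-mono-< {w′} {w} w′<w)) (ℕP.≤-pred size<))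

  reduced-basis : ∀ {u w} → Basis u w → ReducedBasis
  reduced-basis {u} {w} b with norm u ≤? norm w
  ... | yes u≤w = reduce _ (ℕP.n<1+n _) u≤w b
  ... | no  u≰w = reduce _ (ℕP.n<1+n _) (ℤP.<⇒≤ (ℤP.≰⇒> u≰w)) (basis-swap b)

  nonObtuse-basis : ∀ {u w} → Basis u w → ∃₂ λ u′ w′ → Basis u′ w′ × NonObtuse u′ w′
  nonObtuse-basis b with reduced-basis b
  ... | u , w , b′ , reduced with 0ℤ ≤? ip2 u w
  ...   | yes 0≤ip = u , w , b′ , reduced⇒nonObtuse {u} {w} 0≤ip reduced
  ...   | no  0≰ip = u , -ₚ w , basis-neg b′ , reduced⇒nonObtuse {u} { -ₚ w}
    (subst (0ℤ ≤_) (sym (ip2-negʳ u w)) (ℤP.neg-mono-≤ (ℤP.<⇒≤ (ℤP.≰⇒> 0≰ip)))) (reduced-neg {u} {w} reduced)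

-- Orbits and Euler's formula

module _ {n : ℕ} (f : Fin n → Fin n) where

  iter-+ : ∀ i j d → iter f (i ℕ.+ j) d ≡ iter f i (iter f j d)
  iter-+ zero    j d = refl
  iter-+ (suc i) j d = cong f (iter-+ i j d)

  iter-* : ∀ {m d} → iter f m d ≡ d → ∀ t → iter f (t ℕ.* m) d ≡ d
  iter-* fix zero    = refl
  iter-* {m} {d} fix (suc t) = trans (iter-+ m (t ℕ.* m) d) (trans (cong (iter f m) (iter-* fix t)) fix)

  iter-% : ∀ {m d} → iter f (suc m) d ≡ d → ∀ j → iter f j d ≡ iter f (j % suc m) d
  iter-% {m} {d} fix j = begin
    iter f j d
      ≡⟨ cong (λ i → iter f i d) (m≡m%n+[m/n]*n j (suc m)) ⟩
    iter f (j % suc m ℕ.+ j / suc m ℕ.* suc m) d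
      ≡⟨ iter-+ (j % suc m) _ d ⟩
    iter f (j % suc m) (iter f (j / suc m ℕ.* suc m) d)
      ≡⟨ cong (iter f (j % suc m)) (iter-* fix (j / suc m)) ⟩
    iter f (j % suc m) d
      ∎
    where open ≡-Reasoning

  module _ (f-injective : ∀ {x y} → f x ≡ f y → x ≡ y) where

    iter-injective : ∀ j {x y} → iter f j x ≡ iter f j y → x ≡ y
    iter-injective zero    eq = eq
    iter-injective (suc j) eq = iter-injective j (f-injective eq)

    orbit-no-repeat : ∀ {d m} → OrbitSize f d m → ∀ {i j} → i ℕ.< j → j ℕ.< m → iter f i d ≢ iter f j d
    orbit-no-repeat {d} (_ , _ , no-return) {i} {j} i<j j<m eq =
      no-return (j ℕ.∸ i) (ℕP.m<n⇒0<n∸m i<j) (ℕP.≤-<-trans (ℕP.m∸n≤m j i) j<m)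
        (sym (iter-injective i (trans eq (trans (cong (λ k → iter f k d) (sym (ℕP.m+[n∸m]≡n (ℕP.<⇒≤ i<j))))
                                                (iter-+ i (j ℕ.∸ i) d)))))

    orbit-distinct : ∀ {d m} → OrbitSize f d m → ∀ {i j} → i ℕ.< m → j ℕ.< m → iter f i d ≡ iter f j d → i ≡ j
    orbit-distinct size {i} {j} i<m j<m eq with ℕP.<-cmp i j
    ... | tri< i<j _ _ = ⊥-elim (orbit-no-repeat size i<j j<m eq)
    ... | tri≈ _ i≡j _ = i≡j
    ... | tri> _ _ j<i = ⊥-elim (orbit-no-repeat size j<i i<m (sym eq))

    -- A dart is determined by its orbit and by its position in the orbit, counted from a chosen
    -- representative.
    card-by-orbits : ∀ {k m} → HasOrbitCount f k → (∀ d → OrbitSize f d (suc m)) → n ≡ k ℕ.* suc m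
    card-by-orbits {k} {m} (c , surj , c→same , same→c) size =
      ℕP.≤-antisym (FP.injective⇒≤ encode-injective) (FP.injective⇒≤ decode-remQuot-injective)
      where
      rep : Fin k → Fin n
      rep i = proj₁ (surj i)
      c-rep : ∀ i → c (rep i) ≡ i
      c-rep i = proj₂ (surj i)
      c-iter : ∀ t d → c (iter f t d) ≡ c d
      c-iter t d = sym (same→c d (iter f t d) (t , refl))

      position : Fin n → Fin (suc m)
      position x = Fin.fromℕ< (m%n<n (proj₁ (c→same (rep (c x)) x (c-rep (c x)))) (suc m))

      decode : Fin k × Fin (suc m) → Fin n
      decode (i , j) = iter f (toℕ j) (rep i)

      decode-position : ∀ x → decode (c x , position x) ≡ x
      decode-position x = begin
        iter f (toℕ (position x)) r   ≡⟨ cong (λ t → iter f t r) (FP.toℕ-fromℕ< (m%n<n t (suc m))) ⟩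
        iter f (t % suc m) r          ≡⟨ sym (iter-% (proj₁ (proj₂ (size r))) t) ⟩
        iter f t r                    ≡⟨ proj₂ (c→same r x (c-rep (c x))) ⟩
        x                             ∎
        where
        open ≡-Reasoning
        r = rep (c x)
        t = proj₁ (c→same r x (c-rep (c x)))

      decode-orbit : ∀ {i j i′ j′} → decode (i , j) ≡ decode (i′ , j′) → i ≡ i′
      decode-orbit {i} {j} {i′} {j′} eq = begin
        i                        ≡⟨ sym (c-rep i) ⟩
        c (rep i)                ≡⟨ sym (c-iter (toℕ j) (rep i)) ⟩
        c (decode (i , j))       ≡⟨ cong c eq ⟩
        c (decode (i′ , j′))     ≡⟨ c-iter (toℕ j′) (rep i′) ⟩
        c (rep i′)               ≡⟨ c-rep i′ ⟩
        i′                       ∎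
        where open ≡-Reasoning

      decode-injective : ∀ {i j i′ j′} → decode (i , j) ≡ decode (i′ , j′) → (i , j) ≡ (i′ , j′)
      decode-injective {i} {j} {i′} {j′} eq with decode-orbit {i} {j} {i′} {j′} eq
      ... | refl = cong (i ,_) (FP.toℕ-injective (orbit-distinct (size (rep i)) (FP.toℕ<n j) (FP.toℕ<n j′) eq))

      encode : Fin n → Fin (k ℕ.* suc m)
      encode x = Fin.combine (c x) (position x)

      encode-injective : ∀ {x y} → encode x ≡ encode y → x ≡ y
      encode-injective {x} {y} eq with FP.combine-injective (c x) (position x) (c y) (position y) eq
      ... | c≡ , p≡ =
        trans (sym (decode-position x)) (trans (cong₂ (λ i j → decode (i , j)) c≡ p≡) (decode-position y))

      decode-remQuot-injective : ∀ {z z′} → decode (Fin.remQuot {k} (suc m) z) ≡ decode (Fin.remQuot {k} (suc m) z′) →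
        z ≡ z′
      decode-remQuot-injective {z} {z′} eq = trans (sym (FP.combine-remQuot {k} (suc m) z))
        (trans (cong (uncurry Fin.combine) (decode-injective eq)) (FP.combine-remQuot {k} (suc m) z′))

module _ (M : Map) where

  σ-injective : ∀ {x y} → σ M x ≡ σ M y → x ≡ y
  σ-injective {x} {y} eq = trans (sym (σ⁻¹σ M x)) (trans (cong (σ⁻¹ M) eq) (σ⁻¹σ M y))

  φ-injective : ∀ {x y} → φ M x ≡ φ M y → x ≡ y
  φ-injective {x} {y} eq = trans (sym (αα M x)) (trans (cong (α M) (σ-injective eq)) (αα M y))

  double-dual : Iso M (dual (dual M))
  double-dual = record
    { to = λ x → x ; from = λ x → x ; to-from = λ _ → refl ; from-to = λ _ → refl
    ; to-σ = λ d → cong (σ M) (sym (αα M d)) ; to-α = λ _ → refl }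

  -- Euler's formula: 6 (V + F) = 2n + n = 3n for a cubic map with hexagonal faces and no semiedges,
  -- while 6 (2 + E) = 12 + 3n.
  cubic-hexagonal-impossible : Plane M → (∀ d → OrbitSize (σ M) d 3) → (∀ d → OrbitSize (φ M) d 6) →
    (∀ d → α M d ≢ d) → ⊥
  cubic-hexagonal-impossible plane cubic hexagonal no-semiedge = ℕP.m≢1+n+m (3 ℕ.* n M) {11} 3n≡12+3n
    where
    open Plane plane
    open import Data.Nat.Tactic.RingSolver using () renaming (solve-∀ to ℕ-solve-∀)
    n≡3V : n M ≡ V ℕ.* 3
    n≡3V = card-by-orbits (σ M) (σ-injective) vertices cubic
    n≡6F : n M ≡ F ℕ.* 6
    n≡6F = card-by-orbits (φ M) (φ-injective) faces hexagonal
    no-semiedges : semiedgeCount M ≡ 0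
    no-semiedges = cong length (filter-none (λ d → α M d Fin.≟ d) (All.universal no-semiedge (allFin (n M))))
    n≡2E : n M ≡ 2 ℕ.* E
    n≡2E = trans (sym edges) (trans (cong (2 ℕ.* E ℕ.+_) no-semiedges) (ℕP.+-identityʳ _))
    3n≡12+3n : 3 ℕ.* n M ≡ suc (11 ℕ.+ 3 ℕ.* n M)
    3n≡12+3n = begin
      3 ℕ.* n M                       ≡⟨ lemma₁ (n M) ⟩
      2 ℕ.* n M ℕ.+ n M               ≡⟨ cong₂ (λ x y → 2 ℕ.* x ℕ.+ y) n≡3V n≡6F ⟩
      2 ℕ.* (V ℕ.* 3) ℕ.+ F ℕ.* 6     ≡⟨ lemma₂ V F ⟩
      6 ℕ.* (V ℕ.+ F)                 ≡⟨ cong (6 ℕ.*_) euler ⟩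
      6 ℕ.* (2 ℕ.+ E)                 ≡⟨ lemma₃ E ⟩
      suc (11 ℕ.+ 3 ℕ.* (2 ℕ.* E))    ≡⟨ cong (λ m → suc (11 ℕ.+ 3 ℕ.* m)) (sym n≡2E) ⟩
      suc (11 ℕ.+ 3 ℕ.* n M)          ∎
      where
      open ≡-Reasoning
      lemma₁ : ∀ n → 3 ℕ.* n ≡ 2 ℕ.* n ℕ.+ n
      lemma₁ = ℕ-solve-∀
      lemma₂ : ∀ V F → 2 ℕ.* (V ℕ.* 3) ℕ.+ F ℕ.* 6 ≡ 6 ℕ.* (V ℕ.+ F)
      lemma₂ = ℕ-solve-∀
      lemma₃ : ∀ E → 6 ℕ.* (2 ℕ.+ E) ≡ suc (11 ℕ.+ 3 ℕ.* (2 ℕ.* E))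
      lemma₃ = ℕ-solve-∀

-- Unfolding a (0,3,6)-fullerene onto the grid

module Unfolding {M : Map} (fullerene : Fullerene036 M) where

  open Fullerene036 fullerene
  open Plane plane

  Dart′ : Set
  Dart′ = Fin (n M)

  s a : Dart′ → Dart′
  s = φ M
  a = α M

  s⁶ : ∀ x → (s ^ 6) x ≡ x
  s⁶ x with faceSizes x
  ... | inj₁ (_ , s³x≡x , _) = trans (cong (s ^ 3) s³x≡x) s³x≡x
  ... | inj₂ (_ , s⁶x≡x , _) = s⁶x≡x

  sa≡σ : ∀ x → s (a x) ≡ σ M x
  sa≡σ x = cong (σ M) (αα M x)

  sa³ : ∀ x → ((λ y → s (a y)) ^ 3) x ≡ x
  sa³ x = trans (trans (sa≡σ _) (cong (σ M) (trans (sa≡σ _) (cong (σ M) (sa≡σ x)))))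
                (proj₁ (proj₂ (cubic x)))

  open Development s a (αα M) s⁶ sa³

  e₀ : Dart′
  e₀ = some-dart vertices faces euler
    where
    some-dart : ∀ {V F E} → HasOrbitCount (σ M) V → HasOrbitCount (φ M) F → V ℕ.+ F ≡ 2 ℕ.+ E → Dart′
    some-dart {suc V} (_ , onto , _) _ _ = proj₁ (onto 0F)
    some-dart {zero} {suc F} _ (_ , onto , _) _ = proj₁ (onto 0F)
    some-dart {zero} {zero} _ _ ()

  q : Dart → Dart′
  q = develop e₀

  q-equivariant : Equivariant s a q
  q-equivariant = develop-equivariant e₀

  open Equivariant q-equivariant renaming (σ-equivariant to q-σ; α-equivariant to q-α)

  q-onto : ∀ d → ∃ λ x → q x ≡ d
  q-onto d = along (connected e₀ d) ((origin , 0F) , refl)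
    where
    along : ∀ {d e} → Reach M d e → (∃ λ x → q x ≡ d) → ∃ λ x → q x ≡ e
    along here       hit       = hit
    along (viaσ r) (x , qx≡d) = along r (σT (αT x) ,
      trans (q-σ (αT x)) (trans (cong s (q-α x)) (trans (cong (λ y → s (a y)) qx≡d) (sa≡σ _))))
    along (viaα r) (x , qx≡d) = along r (αT x , trans (q-α x) (cong a qx≡d))

  Symmetry : (Dart → Dart) → Set
  Symmetry h = ∀ z → q (h z) ≡ q z

  q-symmetry : ∀ {h} → Automorphism h → ∀ x → q (h x) ≡ q x → Symmetry h
  q-symmetry = symmetry-from-dart q-equivariant

  q-σT^ : ∀ k x → q ((σT ^ k) x) ≡ (s ^ k) (q x)
  q-σT^ = ^-natural q q-σ

  Period : Pt → Set
  Period v = q (v , 0F) ≡ e₀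

  translation-symmetry : ∀ {v} → Period v → Symmetry (motion 0 v)
  translation-symmetry {v} pv =
    q-symmetry (motion-automorphism 0 v) (origin , 0F) (trans (cong (λ p → q (p , 0F)) (⊕-identityˡ v)) pv)

  period-from : ∀ p v → q (p ⊕ v , 0F) ≡ q (p , 0F) → Period v
  period-from p v eq =
    subst (λ r → q (r , 0F) ≡ e₀) (⊕-identityˡ v)
          (q-symmetry (motion-automorphism 0 v) (p , 0F) eq (origin , 0F))

  periods : IsSubgroup Period
  periods = record
    { ∈-origin = refl
    ; ∈-⊕      = λ {v} {w} pv pw → trans (translation-symmetry pw (v , 0F)) pv
    ; ∈-neg    = λ {v} pv →
        trans (sym (translation-symmetry pv (-ₚ v , 0F))) (cong (λ p → q (p , 0F)) (⊕-inverseˡ v))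
    }

  -- Among the n + 1 points 0, v, …, n v two have the same image.
  multiple-period : ∀ v → ∃ λ m → Period ((+ suc m) · v)
  multiple-period v@(v₁ , v₂)
    with FP.pigeonhole (ℕP.n<1+n (n M)) (λ (i : Fin (suc (n M))) → q ((+ toℕ i) · v , 0F))
  ... | i , j , i<j , eq =
    m , period-from ((+ toℕ i) · v) ((+ suc m) · v) (trans (cong (λ p → q (p , 0F)) split) (sym eq))
    where
    m = toℕ j ℕ.∸ suc (toℕ i)
    i+m≡j : toℕ i ℕ.+ suc m ≡ toℕ j
    i+m≡j = trans (ℕP.+-suc (toℕ i) m) (ℕP.m+[n∸m]≡n i<j)
    split : ((+ toℕ i) · v) ⊕ ((+ suc m) · v) ≡ (+ toℕ j) · v
    split = cong₂ _,_
      (trans (sym (ℤP.*-distribʳ-+ v₁ (+ toℕ i) (+ suc m))) (cong (λ k → + k * v₁) i+m≡j))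
      (trans (sym (ℤP.*-distribʳ-+ v₂ (+ toℕ i) (+ suc m))) (cong (λ k → + k * v₂) i+m≡j))

  open Lattice (λ v → q (v , 0F) FP.≟ e₀) periods

  -- basis and half-turn are abstract: unfolding them during later unification is prohibitively expensive.
  abstract
    basis : ∃₂ λ u w → Basis u w × NonObtuse u w
    basis = nonObtuse-basis (proj₂ (proj₂ (axes-basis {m} {m′} period-a period-b)))
      where
      m m′ : ℕ
      m = proj₁ (multiple-period (+ 1 , 0ℤ))
      m′ = proj₁ (multiple-period (0ℤ , + 1))
      period-a : Period (+ suc m , 0ℤ)
      period-a = subst Period (cong₂ _,_ (ℤP.*-identityʳ (+ suc m)) (ℤP.*-zeroʳ (+ suc m)))
                       (proj₂ (multiple-period (+ 1 , 0ℤ)))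
      period-b : Period (0ℤ , + suc m′)
      period-b = subst Period (cong₂ _,_ (ℤP.*-zeroʳ (+ suc m′)) (ℤP.*-identityʳ (+ suc m′)))
                       (proj₂ (multiple-period (0ℤ , + 1)))

  half-turn-from : ∀ c x → q (motion 3 c x) ≡ q x → q (c , 3F) ≡ e₀
  half-turn-from c x eq =
    trans (cong (λ p → q (p , 3F)) (sym (⊕-identityˡ c)))
          (q-symmetry (motion-automorphism 3 c) x eq (origin , 0F))

  -- The half-turn x ↦ c − x sends (origin , 0F) to (c , 3F). A dart fixed by s³ or by a is mapped
  -- back by the half-turn about its gridpoint or its edge midpoint, and Euler's formula provides one.
  abstract
    half-turn : ∃ λ c → q (c , 3F) ≡ e₀
    half-turn with FP.any? (λ e → ((s ^ 3) e FP.≟ e) ⊎-dec (a e FP.≟ e))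
    ... | yes (e , inj₁ s³e≡e) with q-onto e
    ...   | (p , d) , qx≡e = p ⊕ p , half-turn-from (p ⊕ p) (p , d) (begin
      q (rotate 3 p ⊕ (p ⊕ p) , opp d)   ≡⟨ cong (λ r → q (r ⊕ (p ⊕ p) , opp d)) (rotate³ p) ⟩
      q (-ₚ p ⊕ (p ⊕ p) , opp d)         ≡⟨ cong (λ r → q (r , opp d)) (⊕-cancelˡ p p) ⟩
      q ((σT ^ 3) (p , d))               ≡⟨ q-σT^ 3 (p , d) ⟩
      (s ^ 3) (q (p , d))                ≡⟨ trans (cong (s ^ 3) qx≡e) (trans s³e≡e (sym qx≡e)) ⟩
      q (p , d)                          ∎)
      where open ≡-Reasoning
    half-turn | yes (e , inj₂ ae≡e) with q-onto e
    ...   | (p , d) , qx≡e = c , half-turn-from c (p , d) (begin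
      q (rotate 3 p ⊕ c , opp d)          ≡⟨ cong (λ r → q (r ⊕ c , opp d)) (rotate³ p) ⟩
      q (-ₚ p ⊕ c , opp d)                ≡⟨ cong (λ r → q (r , opp d)) (⊕-cancelˡ p (p ⊕ dirVec d)) ⟩
      q (αT (p , d))                      ≡⟨ q-α (p , d) ⟩
      a (q (p , d))                       ≡⟨ trans (cong a qx≡e) (trans ae≡e (sym qx≡e)) ⟩
      q (p , d)                           ∎)
      where
      open ≡-Reasoning
      c : Pt
      c = p ⊕ (p ⊕ dirVec d)
    half-turn | no none =
      ⊥-elim (cubic-hexagonal-impossible M plane cubic hexagonal (λ e ae≡e → none (e , inj₂ ae≡e)))
      where
      hexagonal : ∀ d → OrbitSize (φ M) d 6
      hexagonal d with faceSizes d
      ... | inj₁ (_ , s³d≡d , _) = ⊥-elim (none (d , inj₁ s³d≡d))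
      ... | inj₂ size = size

  c : Pt
  c = proj₁ half-turn

  b₁ b₂ : Pt
  b₁ = proj₁ basis
  b₂ = proj₁ (proj₂ basis)

  lattice-basis : Basis b₁ b₂
  lattice-basis = proj₁ (proj₂ (proj₂ basis))

  open Basis lattice-basis

  triangle : Triangle
  triangle = record
    { A2 = c ; u = b₁ ; w = b₂ ; nondegenerate = independent
    ; angleA = proj₁ angles ; angleB = proj₁ (proj₂ angles) ; angleC = proj₂ (proj₂ angles) }
    where
    angles = proj₂ (proj₂ (proj₂ basis))

  lattice-period : ∀ i j → Period ((i · b₁) ⊕ (j · b₂))
  lattice-period i j = ∈-⊕ {i · b₁} {j · b₂} (∈-scale i {b₁} ∈u) (∈-scale j {b₂} ∈w)
    where open IsSubgroup periods

  act-origin : ∀ γ → q (act triangle γ (origin , 0F)) ≡ e₀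
  act-origin (false , i , j) =
    trans (cong (λ p → q (p , 0F)) (⊕-identityˡ ((i · b₁) ⊕ (j · b₂)))) (lattice-period i j)
  act-origin (true , i , j) =
    trans (translation-symmetry {(i · b₁) ⊕ (j · b₂)} (lattice-period i j) (c ⊖ origin , 3F))
          (trans (cong (λ p → q (p , 3F)) (cong₂ _,_ (ℤP.+-identityʳ (proj₁ c)) (ℤP.+-identityʳ (proj₂ c))))
                 (proj₂ half-turn))

  invariant : ∀ γ → Symmetry (act triangle γ)
  invariant γ = q-symmetry (act-automorphism triangle γ) (origin , 0F) (act-origin γ)

  short-face-free : ∀ {j} → 0 ℕ.< j → j ℕ.< 3 → ∀ e → iter s j e ≢ e
  short-face-free 0<j j<3 e with faceSizes e
  ... | inj₁ (_ , _ , no-return) = no-return _ 0<j j<3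
  ... | inj₂ (_ , _ , no-return) = no-return _ 0<j (ℕP.<-≤-trans j<3 (s≤s (s≤s (s≤s z≤n))))

  σ-fixed-point-free : ∀ e → σ M e ≢ e
  σ-fixed-point-free e = proj₂ (proj₂ (cubic e)) 1 (s≤s z≤n) (s≤s (s≤s z≤n))

  -- With s = σα, each of these says that σ fixes the dart a e.
  s⁵a-fixed-point-free : ∀ e → (s ^ 5) (a e) ≢ e
  s⁵a-fixed-point-free e s⁵ae≡e = σ-fixed-point-free (a e) (sym (trans (sym (s⁶ (a e))) (cong s s⁵ae≡e)))

  as-fixed-point-free : ∀ e → a (s e) ≢ e
  as-fixed-point-free e ase≡e = σ-fixed-point-free (a e) (trans (sym (αα M (s e))) (cong a ase≡e))

  image-preserved : ∀ h → Symmetry h → ∀ z {z′} → h z ≡ z′ → q z′ ≡ q z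
  image-preserved h h-symmetry z hz≡z′ = trans (cong q (sym hz≡z′)) (h-symmetry z)

  no-rotation60 : ∀ v → ¬ Symmetry (motion 1 v)
  no-rotation60 v sym-v with rotation60-fixes v
  ... | c , fixes = short-face-free (s≤s z≤n) (s≤s (s≤s z≤n)) (q (c , 0F))
    (image-preserved (motion 1 v) sym-v (c , 0F) fixes)

  no-rotation300 : ∀ v → ¬ Symmetry (motion 5 v)
  no-rotation300 v sym-v with rotation300-fixes v
  ... | c , fixes = short-face-free (s≤s z≤n) (s≤s (s≤s z≤n)) (q (c , 0F))
    (sym (image-preserved (motion 5 v) sym-v (σT (c , 0F)) fixes))

  no-rotation120 : ∀ v → ¬ Symmetry (motion 2 v)
  no-rotation120 v sym-v with rotation120-fixes v
  ... | z , inj₁ fixes = short-face-free (s≤s z≤n) (s≤s (s≤s (s≤s z≤n))) (q z)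
    (trans (sym (q-σT^ 2 z)) (image-preserved (motion 2 v) sym-v z fixes))
  ... | z , inj₂ fixes = s⁵a-fixed-point-free (q z)
    (trans (sym (trans (q-σT^ 5 (αT z)) (cong (s ^ 5) (q-α z)))) (image-preserved (motion 2 v) sym-v z fixes))

  no-rotation240 : ∀ v → ¬ Symmetry (motion 4 v)
  no-rotation240 v sym-v with rotation240-fixes v
  ... | z , inj₁ fixes = short-face-free (s≤s z≤n) (s≤s (s≤s (s≤s z≤n))) (q z)
    (trans (sym (q-σT^ 2 z)) (sym (image-preserved (motion 4 v) sym-v ((σT ^ 2) z) fixes)))
  ... | z , inj₂ fixes = as-fixed-point-free (q z)
    (trans (sym (trans (q-α (σT z)) (cong a (q-σ z)))) (image-preserved (motion 4 v) sym-v z fixes))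

  deck : ∀ (k : Fin 6) v {x y} → motion (toℕ k) v x ≡ y → Symmetry (motion (toℕ k) v) →
    ∃ λ γ → act triangle γ x ≡ y
  deck 0F v {p , d} refl sym-v with spans v (subst Period (⊕-identityˡ v) (sym-v (origin , 0F)))
  ... | i , j , v≡ = (false , i , j) , cong (λ r → (p ⊕ r , d)) (sym v≡)
  deck 3F v {p , d} refl sym-v with spans (rotate 3 c ⊕ v) (trans (sym-v (c , 3F)) (proj₂ half-turn))
  ... | i , j , v≡ = (true , i , j) , cong (_, opp d) (trans (cong ((c ⊖ p) ⊕_) (sym v≡)) (reflect c p v))
    where
    reflect : ∀ o p v → (o ⊖ p) ⊕ (rotate 3 o ⊕ v) ≡ rotate 3 p ⊕ v
    reflect o@(o₁ , o₂) p@(p₁ , p₂) v@(v₁ , v₂) =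
      trans (cong (λ r → (o ⊖ p) ⊕ (r ⊕ v)) (rotate³ o))
            (trans (cong₂ _,_ (lemma o₁ p₁ v₁) (lemma o₂ p₂ v₂)) (cong (_⊕ v) (sym (rotate³ p))))
      where
      lemma : ∀ c p v → c - p + (- c + v) ≡ - p + v
      lemma = solve-∀
  deck 1F v _ sym-v = ⊥-elim (no-rotation60 v sym-v)
  deck 2F v _ sym-v = ⊥-elim (no-rotation120 v sym-v)
  deck 4F v _ sym-v = ⊥-elim (no-rotation240 v sym-v)
  deck 5F v _ sym-v = ⊥-elim (no-rotation300 v sym-v)

  fibres : ∀ x y → q x ≡ q y → ∃ λ γ → act triangle γ x ≡ y
  fibres x@(p , d) y@(p′ , d′) qx≡qy =
    deck k v moves (q-symmetry (motion-automorphism (toℕ k) v) x (trans (cong q moves) (sym qx≡qy)))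
    where
    k = turns d d′
    v = p′ ⊕ -ₚ rotate (toℕ k) p
    moves : motion (toℕ k) v x ≡ y
    moves = cong₂ _,_ (cancel (rotate (toℕ k) p) p′) (rot^turns d d′)
      where
      cancel : ∀ r p′ → r ⊕ (p′ ⊕ -ₚ r) ≡ p′
      cancel (r₁ , r₂) (p₁ , p₂) = cong₂ _,_ (lemma r₁ p₁) (lemma r₂ p₂)
        where
        lemma : ∀ r p → r + (p + - r) ≡ p
        lemma = solve-∀

  folding : IsFolding triangle (dual M)
  folding = record
    { q = q ; onto = q-onto ; fibres = fibres ; invar = invariant ; q-σ = q-σ ; q-α = q-α }

theorem6 : (M : Map) → Fullerene036 M →
    Σ Triangle λ t → Σ Map λ Gstar → IsFolding t Gstar × Iso M (dual Gstar)
theorem6 M fullerene = triangle , dual M , folding , double-dual M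
  where open Unfolding fullerene
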